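{- Let $\varphi,\psi$ be arithmetic ground sentences over a signature $\Sigma$. Then: (1) if $I(\varphi)=\top$, then $I(\varphi\vee\psi)=\top$; (2) if $I(\varphi)=\top$ and $I(\psi)=\top$, then $I(\varphi\wedge\psi)=\top$.
   Context: Many-sorted first-order logic with equality over a signature $\Sigma=(O,C,F,\sigma)$ where sorts are pairs in $O\times O$, $C$ contains zero constants $0_{u,v}$ (sort $(u,v)$) and possibly other (non-zero) constant symbols, and $F$ contains the arithmetic function symbols $-_{u,v}$ (type $(u,v)\to(u,v)$), $+_{u,v}$ (type $(u,v)\times(u,v)\to(u,v)$), $\cdot_{u,v,w}$ (type $(w,v)\times(u,w)\to(u,v)$). Atomic formulas are $s\approx t$ for terms of equal sort. A ground sentence is a formula without variables (hence without quantifiers); it is arithmetic if all function symbols in it are arithmetic. Translation to polynomials: for an arithmetic ground sentence $\varphi$ let $X_\varphi=\{x_c : c \text{ a non-zero constant symbol occurring in }\varphi\}$ and map terms into the free algebra $\mathbb Z\langle X_\varphi\rangle$ (noncommutative polynomials) by $0_{u,v}\mapsto 0$, $c\mapsto x_c$, $-t\mapsto -t$, $s+t\mapsto s+t$, $s\cdot t\mapsto s\cdot t$; write $s-t$ for the image of $s$ minus the image of $t$. $\mathrm{CNF}(\varphi)$ is obtained by exhaustively applying, in this order, (i) $\psi_1\rightarrow\psi_2\rightsquigarrow\lnot\psi_1\vee\psi_2$, (ii) $\lnot\lnot\psi\rightsquigarrow\psi$, $\lnot(\psi_1\wedge\psi_2)\rightsquigarrow\lnot\psi_1\vee\lnot\psi_2$,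 $\lnot(\psi_1\vee\psi_2)\rightsquigarrow\lnot\psi_1\wedge\lnot\psi_2$, (iii) $\psi\vee(\psi_1\wedge\psi_2)\rightsquigarrow(\psi\vee\psi_1)\wedge(\psi\vee\psi_2)$, with $\wedge,\vee$ treated as associative and commutative; it is a conjunction of clauses (disjunctions of literals $s\approx t$, $s\not\approx t$). For a clause $C=\bigvee_{j=1}^n s_j\not\approx t_j\vee\bigvee_{k=1}^{n'}p_k\approx q_k$, the idealisation $I(C)$ is the statement "there is $1\le k\le n'$ with $p_k-q_k\in(s_1-t_1,\dots,s_n-t_n)$", where $(\cdot)$ denotes the two-sided ideal generated in $\mathbb Z\langle X_C\rangle$ (with $(\emptyset)=\{0\}$). For an arithmetic ground sentence $\varphi$, $I(\varphi)$ is the conjunction of $I(C)$ over all clauses $C$ of $\mathrm{CNF}(\varphi)$; its truth value is $\top$ or $\bot$. -}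

module Defs where

open import Data.Bool using (Bool; true; false; not)
open import Data.Product using (Σ; ∃; _×_; _,_; proj₁; proj₂)
open import Data.List using (List; []; _∷_; _++_; concatMap; map; foldr)
open import Data.List.Membership.Propositional using (_∈_)
open import Data.List.Relation.Unary.All using (All)
open import Data.List.Relation.Unary.Any using (Any)
open import Relation.Binary.PropositionalEquality using (_≡_)

-- Sorts are pairs (u , v) ∈ O × O.
-- `Const` are the NON-ZERO constant symbols with their sorts; the zero
-- constants 0_{u,v} and the arithmetic function symbols -, +, · are
-- built into the term syntax below (only arithmetic sentences occur).
record Signature : Set₁ where
  field
    Obj   : Set
    Const : Set
    sort  : Const → Obj × Obj

module _ (S : Signature) where
  open Signature S

  data Term : Obj → Obj → Set where
    zer : ∀ {u v} → Term u v
    con : (c : Const) → Term (proj₁ (sort c)) (proj₂ (sort c))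
    neg : ∀ {u v} → Term u v → Term u v
    add : ∀ {u v} → Term u v → Term u v → Term u v
    mul : ∀ {u v w} → Term w v → Term u w → Term u v

  data Sentence : Set where
    _≈ₜ_ : ∀ {u v} → Term u v → Term u v → Sentence
    ¬ₛ_  : Sentence → Sentence
    _∧ₛ_ : Sentence → Sentence → Sentence
    _∨ₛ_ : Sentence → Sentence → Sentence
    _⇒ₛ_ : Sentence → Sentence → Sentence

  record Literal : Set where
    constructor lit
    field
      positive : Bool
      {lu lv}  : Obj
      lhs rhs  : Term lu lv

  Clause : Set
  Clause = List Literal

  disj : List Clause → List Clause → List Clause
  disj cs ds = concatMap (λ c → map (λ d → c ++ d) ds) cs

  -- CNF: cnf true φ is CNF(φ), cnf false φ is CNF(¬φ); this realises the
  -- rewriting (i),(ii),(iii) modulo associativity/commutativity of ∧,∨.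
  cnf : Bool → Sentence → List Clause
  cnf b     (s ≈ₜ t) = (lit b s t ∷ []) ∷ []
  cnf b     (¬ₛ φ)   = cnf (not b) φ
  cnf true  (φ ∧ₛ ψ) = cnf true φ ++ cnf true ψ
  cnf false (φ ∧ₛ ψ) = disj (cnf false φ) (cnf false ψ)
  cnf true  (φ ∨ₛ ψ) = disj (cnf true φ) (cnf true ψ)
  cnf false (φ ∨ₛ ψ) = cnf false φ ++ cnf false ψ
  cnf true  (φ ⇒ₛ ψ) = disj (cnf false φ) (cnf true ψ)
  cnf false (φ ⇒ₛ ψ) = cnf true φ ++ cnf false ψ

  CNF : Sentence → List Clause
  CNF = cnf true

  data Poly : Set where
    var  : Const → Poly
    𝟘 𝟙  : Poly
    _⊕_  : Poly → Poly → Poly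
    ⊝_   : Poly → Poly
    _⊗_  : Poly → Poly → Poly

  infixl 6 _⊕_
  infixl 7 _⊗_

  -- Equality in the free algebra ℤ⟨X⟩ (= free unital ring on X):
  -- the least congruence containing the ring axioms.
  infix 4 _≃_
  data _≃_ : Poly → Poly → Set where
    refl≃  : ∀ {p} → p ≃ p
    sym≃   : ∀ {p q} → p ≃ q → q ≃ p
    trans≃ : ∀ {p q r} → p ≃ q → q ≃ r → p ≃ r
    ⊕-cong : ∀ {p p' q q'} → p ≃ p' → q ≃ q' → p ⊕ q ≃ p' ⊕ q'
    ⊝-cong : ∀ {p p'} → p ≃ p' → ⊝ p ≃ ⊝ p'
    ⊗-cong : ∀ {p p' q q'} → p ≃ p' → q ≃ q' → p ⊗ q ≃ p' ⊗ q'
    ⊕-assoc : ∀ {p q r} → (p ⊕ q) ⊕ r ≃ p ⊕ (q ⊕ r)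
    ⊕-comm  : ∀ {p q} → p ⊕ q ≃ q ⊕ p
    ⊕-idˡ   : ∀ {p} → 𝟘 ⊕ p ≃ p
    ⊝-invˡ  : ∀ {p} → (⊝ p) ⊕ p ≃ 𝟘
    ⊗-assoc : ∀ {p q r} → (p ⊗ q) ⊗ r ≃ p ⊗ (q ⊗ r)
    ⊗-idˡ   : ∀ {p} → 𝟙 ⊗ p ≃ p
    ⊗-idʳ   : ∀ {p} → p ⊗ 𝟙 ≃ p
    distribˡ : ∀ {p q r} → p ⊗ (q ⊕ r) ≃ (p ⊗ q) ⊕ (p ⊗ r)
    distribʳ : ∀ {p q r} → (q ⊕ r) ⊗ p ≃ (q ⊗ p) ⊕ (r ⊗ p)

  vars : Poly → List Const
  vars (var c)  = c ∷ []
  vars 𝟘        = []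
  vars 𝟙        = []
  vars (p ⊕ q)  = vars p ++ vars q
  vars (⊝ p)    = vars p
  vars (p ⊗ q)  = vars p ++ vars q

  InAlg : List Const → Poly → Set
  InAlg X p = All (_∈ X) (vars p)

  ⟦_⟧ : ∀ {u v} → Term u v → Poly
  ⟦ zer ⟧     = 𝟘
  ⟦ con c ⟧   = var c
  ⟦ neg t ⟧   = ⊝ ⟦ t ⟧
  ⟦ add s t ⟧ = ⟦ s ⟧ ⊕ ⟦ t ⟧
  ⟦ mul s t ⟧ = ⟦ s ⟧ ⊗ ⟦ t ⟧

  diff : Literal → Poly
  diff (lit _ s t) = ⟦ s ⟧ ⊕ (⊝ ⟦ t ⟧)

  consts : ∀ {u v} → Term u v → List Const
  consts zer       = []
  consts (con c)   = c ∷ []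
  consts (neg t)   = consts t
  consts (add s t) = consts s ++ consts t
  consts (mul s t) = consts s ++ consts t

  X-clause : Clause → List Const
  X-clause = concatMap (λ l → consts (Literal.lhs l) ++ consts (Literal.rhs l))

  -- two-sided ideal (G) of ℤ⟨X⟩: p ∈ (G) iff p = Σᵢ aᵢ gᵢ bᵢ in ℤ⟨X⟩
  -- for finitely many aᵢ, bᵢ ∈ ℤ⟨X⟩ and gᵢ ∈ G  (so (∅) = {0}).
  record IdealTerm (X : List Const) (G : List Poly) : Set where
    constructor itm
    field
      a g b : Poly
      a∈X   : InAlg X a
      g∈G   : g ∈ G
      b∈X   : InAlg X b

  sumIdeal : ∀ {X G} → List (IdealTerm X G) → Poly
  sumIdeal = foldr (λ t acc → (IdealTerm.a t ⊗ IdealTerm.g t ⊗ IdealTerm.b t) ⊕ acc) 𝟘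

  InIdeal : List Const → List Poly → Poly → Set
  InIdeal X G p = Σ (List (IdealTerm X G)) λ ts → p ≃ sumIdeal ts

  negGens : Clause → List Poly
  negGens [] = []
  negGens (lit true  s t ∷ C) = negGens C
  negGens (lit false s t ∷ C) = diff (lit false s t) ∷ negGens C

  IsPos : Literal → Set
  IsPos l = Literal.positive l ≡ true

  I-clause : Clause → Set
  I-clause C = Any (λ l → IsPos l × InIdeal (X-clause C) (negGens C) (diff l)) C

  I : Sentence → Set
  I φ = All I-clause (CNF φ)

{-# OPTIONS --safe #-}
module Submission where

-- Every clause of CNF(φ ∨ ψ) is C ∨ D with C a clause of CNF(φ), and
-- idealisation is monotone under adding literals to a clause: a new
-- negative literal only enlarges the generating set of the ideal (and the
-- variable set of the ambient algebra), a new positive literal only adds a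
-- candidate. CNF(φ ∧ ψ) is the concatenation of CNF(φ) and CNF(ψ).

open import Defs
open import Data.Bool using (true; false)
open import Data.List using (List; []; _∷_; _++_; map)
open import Data.List.Properties using (concatMap-++)
open import Data.List.Relation.Binary.Subset.Propositional using (_⊆_)
open import Data.List.Relation.Binary.Subset.Propositional.Properties using (xs⊆xs++ys)
open import Data.List.Relation.Unary.All as All using (All)
open import Data.List.Relation.Unary.All.Properties using (++⁺; map⁺; concat⁺)
open import Data.List.Relation.Unary.Any as Any using ()
open import Data.List.Relation.Unary.Any.Properties using (++⁺ˡ)
open import Data.Product using (_×_; _,_)
open import Relation.Binary.PropositionalEquality using (_≡_; refl; sym; cong; subst)

module _ (S : Signature) where

  weakenIdealTerm : ∀ {X X′ G G′} → X ⊆ X′ → G ⊆ G′ → IdealTerm S X G → IdealTerm S X′ G′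
  weakenIdealTerm X⊆X′ G⊆G′ (itm a g b a∈X g∈G b∈X) =
    itm a g b (All.map X⊆X′ a∈X) (G⊆G′ g∈G) (All.map X⊆X′ b∈X)

  sumIdeal-weaken : ∀ {X X′ G G′} (X⊆X′ : X ⊆ X′) (G⊆G′ : G ⊆ G′) (ts : List (IdealTerm S X G)) →
                    sumIdeal S (map (weakenIdealTerm X⊆X′ G⊆G′) ts) ≡ sumIdeal S ts
  sumIdeal-weaken X⊆X′ G⊆G′ []       = refl
  sumIdeal-weaken X⊆X′ G⊆G′ (t ∷ ts) = cong (_ ⊕_) (sumIdeal-weaken X⊆X′ G⊆G′ ts)

  InIdeal-mono : ∀ {X X′ G G′ p} → X ⊆ X′ → G ⊆ G′ → InIdeal S X G p → InIdeal S X′ G′ p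
  InIdeal-mono X⊆X′ G⊆G′ (ts , p≃Σts) =
    map (weakenIdealTerm X⊆X′ G⊆G′) ts ,
    subst (_≃_ S _) (sym (sumIdeal-weaken X⊆X′ G⊆G′ ts)) p≃Σts

  negGens-++ : ∀ (C D : Clause S) → negGens S (C ++ D) ≡ negGens S C ++ negGens S D
  negGens-++ []                  D = refl
  negGens-++ (lit true  s t ∷ C) D = negGens-++ C D
  negGens-++ (lit false s t ∷ C) D = cong (_ ∷_) (negGens-++ C D)

  X-clause-⊆-++ : ∀ (C D : Clause S) → X-clause S C ⊆ X-clause S (C ++ D)
  X-clause-⊆-++ C D = subst (X-clause S C ⊆_) (sym (concatMap-++ _ C D)) (xs⊆xs++ys _ _)

  negGens-⊆-++ : ∀ (C D : Clause S) → negGens S C ⊆ negGens S (C ++ D)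
  negGens-⊆-++ C D = subst (negGens S C ⊆_) (sym (negGens-++ C D)) (xs⊆xs++ys _ _)

  I-clause-++ : ∀ (C D : Clause S) → I-clause S C → I-clause S (C ++ D)
  I-clause-++ C D I[C] = ++⁺ˡ (Any.map (λ { (pos , ∈ideal) → pos , weaken ∈ideal }) I[C])
    where
    weaken : ∀ {p} → InIdeal S (X-clause S C) (negGens S C) p → InIdeal S (X-clause S (C ++ D)) (negGens S (C ++ D)) p
    weaken = InIdeal-mono (X-clause-⊆-++ C D) (negGens-⊆-++ C D)

  I-disj : ∀ (Cs Ds : List (Clause S)) → All (I-clause S) Cs → All (I-clause S) (disj S Cs Ds)
  I-disj Cs Ds I[Cs] = concat⁺ (map⁺ (All.map I-extensions I[Cs]))
    where
    I-extensions : ∀ {C} → I-clause S C → All (I-clause S) (map (C ++_) Ds)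
    I-extensions {C} I[C] = map⁺ (All.tabulate (λ {D} _ → I-clause-++ C D I[C]))

lemma3p6 : (S : Signature) (φ ψ : Sentence S) →
    (I S φ → I S (φ ∨ₛ ψ)) × (I S φ → I S ψ → I S (φ ∧ₛ ψ))
lemma3p6 S φ ψ = I-disj S (CNF S φ) (CNF S ψ) , ++⁺
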